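{- Let $C_n = v_1 v_2\cdots v_n$ be a cycle on $n\ge 3$ vertices. Then: (i) There exists a set $A\subset V(C_n)$ such that the complement $V(C_n)\setminus A$ contains at most one pair of vertices adjacent in $C_n$, and $C_n^2[A]$ is an even cycle or a path. (ii) If $n$ is odd and $i\in\{3,\ldots,n-1\}$, then there exists a set $A\subset V(C_n)$ and some $j\in\{i-1,i+1\}$ such that $\{v_1,v_i,v_j\}\cap A=\emptyset$, the pair $v_iv_j$ is the only pair of vertices adjacent in $C_n$ that lies in $V(C_n)\setminus A$, and $C_n^2[A]$ is a path.
   Context: For a graph $H$, $H^2$ denotes its square: the graph on $V(H)$ in which two distinct vertices are adjacent iff their distance in $H$ is at most $2$; $H^2[A]$ is the subgraph of $H^2$ induced by $A$. -}

module Defs where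

open import Data.Nat using (ℕ; zero; suc; _+_; _%_; _≤_; _∸_)
open import Data.Fin using (Fin; toℕ)
open import Data.Fin.Subset using (Subset; _∈_; _∉_)
open import Data.Product using (Σ; ∃; _×_; _,_)
open import Data.Sum using (_⊎_)
open import Relation.Binary.PropositionalEquality using (_≡_; _≢_)
open import Relation.Nullary using (¬_)
open import Function.Bundles using (_⇔_)

-- Vertex v_{k+1} of the cycle C_n = v_1 v_2 ... v_n is the element k : Fin n.
CycleAdj : (m : ℕ) → Fin m → Fin m → Set
CycleAdj m a b = (suc (toℕ a) ≡ toℕ b) ⊎ (suc (toℕ b) ≡ toℕ a)
               ⊎ (toℕ a ≡ 0 × suc (toℕ b) ≡ m) ⊎ (toℕ b ≡ 0 × suc (toℕ a) ≡ m)

PathAdj : (m : ℕ) → Fin m → Fin m → Set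
PathAdj m a b = (suc (toℕ a) ≡ toℕ b) ⊎ (suc (toℕ b) ≡ toℕ a)

SqAdj : (n : ℕ) → Fin n → Fin n → Set
SqAdj n x y = x ≢ y × (CycleAdj n x y ⊎ ∃ λ z → CycleAdj n x z × CycleAdj n z y)

InducedIso : (n : ℕ) → Subset n → (m : ℕ) → (Fin m → Fin m → Set) → Set
InducedIso n A m G = Σ (Fin m → Fin n) λ f →
    (∀ a → f a ∈ A)
  × (∀ x → x ∈ A → ∃ λ a → f a ≡ x)
  × (∀ a b → f a ≡ f b → a ≡ b)
  × (∀ a b → SqAdj n (f a) (f b) ⇔ G a b)

SqIsPath : (n : ℕ) → Subset n → Set
SqIsPath n A = ∃ λ m → 1 ≤ m × InducedIso n A m (PathAdj m)

SqIsEvenCycle : (n : ℕ) → Subset n → Set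
SqIsEvenCycle n A = ∃ λ m → 3 ≤ m × m % 2 ≡ 0 × InducedIso n A m (CycleAdj m)

AtMostOneAdjPairOutside : (n : ℕ) → Subset n → Set
AtMostOneAdjPairOutside n A = ∀ x y x' y' →
  x ∉ A → y ∉ A → CycleAdj n x y →
  x' ∉ A → y' ∉ A → CycleAdj n x' y' →
  (x ≡ x' × y ≡ y') ⊎ (x ≡ y' × y ≡ x')

OnlyAdjPairOutside : (n : ℕ) → Subset n → Fin n → Fin n → Set
OnlyAdjPairOutside n A i j = ∀ x y →
  x ∉ A → y ∉ A → CycleAdj n x y →
  (x ≡ i × y ≡ j) ⊎ (x ≡ j × y ≡ i)

module Submission where

open import Defs
open import Data.Nat using (ℕ; zero; suc; _+_; _*_; _%_; _/_; _≤_; _≰_; _<_; _∸_; z≤n; s≤s; NonZero; >-nonZero)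
open import Data.Nat.Properties
open import Data.Nat.Tactic.RingSolver using (solve-∀)
open import Data.Nat.DivMod using (m*n%n≡0; m%n<n; m%n≤n; m≡m%n+[m/n]*n; [m+n]%n≡m%n; m<n⇒m%n≡m; %-distribˡ-+; m%n%n≡m%n; n%n≡0)
open import Data.Fin using (Fin; toℕ; fromℕ<) renaming (_≟_ to _≟ᶠ_)
open import Data.Fin.Properties using (toℕ-fromℕ<; toℕ-injective; toℕ<n; any?)
open import Data.Fin.Subset using (Subset; _∈_; _∉_)
open import Data.Vec using (tabulate)
open import Data.Vec.Properties using (lookup∘tabulate; lookup⇒[]=; []=⇒lookup)
open import Data.Product using (∃; _×_; _,_; proj₁; proj₂)
open import Data.Sum using (_⊎_; inj₁; inj₂; swap)
open import Function using (_∘_)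
open import Function.Bundles using (_⇔_; mk⇔; Equivalence)
open import Function.Construct.Composition using (_⇔-∘_)
open import Function.Construct.Symmetry using (⇔-sym)
open import Relation.Binary.PropositionalEquality
open import Relation.Nullary using (yes; no; does; contradiction)
open import Relation.Nullary.Decidable using (dec-true)
open import Relation.Unary using (Pred; Decidable)
open import Relation.Binary.Definitions using (tri<; tri≈; tri>)

-- A natural number X names the vertex X mod n of C_n. Let u 0 < u 1 < ... < u ℓ be a walk
-- in ℕ with steps of size 1 or 2, no two consecutive steps of size 1, and span
-- u ℓ - u 0 = n - 3, and let A be the set of vertices it visits. Consecutive terms are at
-- distance at most 2 in C_n, while non-consecutive terms are at distance between 3 and
-- n - 3 along the walk, hence at cyclic distance at least 3; so C_n²[A] is the path
-- u 0, ..., u ℓ. A vertex outside A is either skipped by a step of size 2, and then both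
-- its neighbours lie in A, or one of u ℓ + 1 and u ℓ + 2; these two form the only adjacent
-- pair outside A. For odd n = 2(q + r) + 3 the walk 2q + 2, 2q + 4, ... of step 2 wraps
-- around the cycle, leaves out exactly {2q, 2q + 1}, and skips the vertex 0 when q ≥ 1;
-- for even n the walk 0, 1, 3, 5, ..., n - 3 serves part (i).

module _ {n p} {P : Pred (Fin n) p} (P? : Decidable P) where

  ∈-tabulate⁺ : ∀ {x} → P x → x ∈ tabulate (does ∘ P?)
  ∈-tabulate⁺ {x} px = lookup⇒[]= x _ (trans (lookup∘tabulate (does ∘ P?) x) (dec-true (P? x) px))

  ∈-tabulate⁻ : ∀ {x} → x ∈ tabulate (does ∘ P?) → P x
  ∈-tabulate⁻ {x} x∈ with P? x | trans (sym (lookup∘tabulate (does ∘ P?) x)) ([]=⇒lookup x∈)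
  ... | yes px | _ = px
  ... | no _   | ()

cycleAdj-sym : ∀ {m} {x y : Fin m} → CycleAdj m x y → CycleAdj m y x
cycleAdj-sym (inj₁ e)               = inj₂ (inj₁ e)
cycleAdj-sym (inj₂ (inj₁ e))        = inj₁ e
cycleAdj-sym (inj₂ (inj₂ (inj₁ e))) = inj₂ (inj₂ (inj₂ e))
cycleAdj-sym (inj₂ (inj₂ (inj₂ e))) = inj₂ (inj₂ (inj₁ e))

sqAdj-sym : ∀ {m} {x y : Fin m} → SqAdj m x y → SqAdj m y x
sqAdj-sym (x≢y , inj₁ c)             = x≢y ∘ sym , inj₁ (cycleAdj-sym c)
sqAdj-sym (x≢y , inj₂ (z , c₁ , c₂)) = x≢y ∘ sym , inj₂ (z , cycleAdj-sym c₂ , cycleAdj-sym c₁)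

pathAdj-ordered : ∀ {m} {a b : Fin m} → toℕ a ≤ toℕ b → PathAdj m a b ⇔ toℕ b ≡ suc (toℕ a)
pathAdj-ordered {a = a} {b} a≤b = mk⇔ to (inj₁ ∘ sym)
  where
    to : PathAdj _ a b → toℕ b ≡ suc (toℕ a)
    to (inj₁ 1+a≡b) = sym 1+a≡b
    to (inj₂ 1+b≡a) = contradiction (subst (_≤ toℕ b) (sym 1+b≡a) a≤b) 1+n≰n

onlyAdjPair⇒atMostOne : ∀ {n A} {i j : Fin n} → OnlyAdjPairOutside n A i j → AtMostOneAdjPairOutside n A
onlyAdjPair⇒atMostOne only x y x' y' x∉ y∉ c x'∉ y'∉ c'
  with only x y x∉ y∉ c | only x' y' x'∉ y'∉ c'
... | inj₁ (refl , refl) | inj₁ (refl , refl) = inj₁ (refl , refl)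
... | inj₁ (refl , refl) | inj₂ (refl , refl) = inj₂ (refl , refl)
... | inj₂ (refl , refl) | inj₁ (refl , refl) = inj₂ (refl , refl)
... | inj₂ (refl , refl) | inj₂ (refl , refl) = inj₁ (refl , refl)

onlyAdjPair-sym : ∀ {n A} {i j : Fin n} → OnlyAdjPairOutside n A i j → OnlyAdjPairOutside n A j i
onlyAdjPair-sym only x y x∉ y∉ c = swap (only x y x∉ y∉ c)

module Cycle (n : ℕ) (3≤n : 3 ≤ n) where

  instance
    n-nonZero : NonZero n
    n-nonZero = >-nonZero (≤-trans (s≤s z≤n) 3≤n)

  1<n : 1 < n
  1<n = ≤-trans (s≤s (s≤s z≤n)) 3≤n

  vertex : ℕ → Fin n
  vertex X = fromℕ< (m%n<n X n)

  toℕ-vertex : ∀ X → toℕ (vertex X) ≡ X % n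
  toℕ-vertex X = toℕ-fromℕ< (m%n<n X n)

  toℕ-vertex-< : ∀ {X} → X < n → toℕ (vertex X) ≡ X
  toℕ-vertex-< {X} X<n = trans (toℕ-vertex X) (m<n⇒m%n≡m X<n)

  vertex-toℕ : ∀ x → vertex (toℕ x) ≡ x
  vertex-toℕ x = toℕ-injective (toℕ-vertex-< (toℕ<n x))

  vertex-+n : ∀ X → vertex (X + n) ≡ vertex X
  vertex-+n X = toℕ-injective (begin
    toℕ (vertex (X + n)) ≡⟨ toℕ-vertex (X + n) ⟩
    (X + n) % n          ≡⟨ [m+n]%n≡m%n X n ⟩
    X % n                ≡⟨ toℕ-vertex X ⟨
    toℕ (vertex X)       ∎)
    where open ≡-Reasoning

  k+m<m+n : ∀ {k} m → k < n → k + m < m + n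
  k+m<m+n {k} m k<n = subst (k + m <_) (+-comm n m) (+-monoˡ-< m k<n)

  -- Write X and Y as r + a * n and r + b * n; the window forces a ≡ b.
  %-injective-window : ∀ {X Y} → X ≤ Y → Y < X + n → X % n ≡ Y % n → X ≡ Y
  %-injective-window {X} {Y} X≤Y Y<X+n X%≡Y% = begin
      X                 ≡⟨ X≡r+a*n ⟩
      r + X / n * n     ≡⟨ cong (λ q → r + q * n) a≡b ⟩
      r + Y / n * n     ≡⟨ m≡m%n+[m/n]*n Y n ⟨
      Y                 ∎
    where
      open ≡-Reasoning
      r = Y % n
      X≡r+a*n : X ≡ r + X / n * n
      X≡r+a*n = trans (m≡m%n+[m/n]*n X n) (cong (_+ X / n * n) X%≡Y%)
      a≤b : X / n ≤ Y / n
      a≤b = *-cancelʳ-≤ _ _ n (+-cancelˡ-≤ r _ _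
              (subst₂ _≤_ X≡r+a*n (m≡m%n+[m/n]*n Y n) X≤Y))
      b<1+a : Y / n < suc (X / n)
      b<1+a = *-cancelʳ-< n _ _ (+-cancelˡ-< r _ _ (subst₂ _<_ (m≡m%n+[m/n]*n Y n) X+n≡ Y<X+n))
        where
          X+n≡ : X + n ≡ r + suc (X / n) * n
          X+n≡ = trans (cong (_+ n) X≡r+a*n) (trans (+-assoc r _ n) (cong (r +_) (+-comm (X / n * n) n)))
      a≡b : X / n ≡ Y / n
      a≡b = ≤-antisym a≤b (≤-pred b<1+a)

  vertex-injective-window : ∀ {X Y} → X ≤ Y → Y < X + n → vertex X ≡ vertex Y → X ≡ Y
  vertex-injective-window {X} {Y} X≤Y Y<X+n vX≡vY =
    %-injective-window X≤Y Y<X+n (trans (sym (toℕ-vertex X)) (trans (cong toℕ vX≡vY) (toℕ-vertex Y)))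

  vertex-injectiveOn-window : ∀ {B X Y} → B ≤ X × X < B + n → B ≤ Y × Y < B + n →
                              vertex X ≡ vertex Y → X ≡ Y
  vertex-injectiveOn-window {B} {X} {Y} (B≤X , X<B+n) (B≤Y , Y<B+n) vX≡vY with ≤-total X Y
  ... | inj₁ X≤Y = vertex-injective-window X≤Y (<-≤-trans Y<B+n (+-monoˡ-≤ n B≤X)) vX≡vY
  ... | inj₂ Y≤X = sym (vertex-injective-window Y≤X (<-≤-trans X<B+n (+-monoˡ-≤ n B≤Y)) (sym vX≡vY))

  vertex-window : ∀ X (z : Fin n) → ∃ λ Z → (X ≤ Z × Z < X + n) × vertex Z ≡ z
  vertex-window X z = X + w % n , (m≤m+n X _ , +-monoʳ-< X (m%n<n w n)) , toℕ-injective (begin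
      toℕ (vertex (X + w % n))    ≡⟨ toℕ-vertex (X + w % n) ⟩
      (X + w % n) % n             ≡⟨ %-distribˡ-+ X (w % n) n ⟩
      (X % n + w % n % n) % n     ≡⟨ cong (λ t → (X % n + t) % n) (m%n%n≡m%n w n) ⟩
      (X % n + w % n) % n         ≡⟨ cong (λ t → (t + w % n) % n) (m%n%n≡m%n X n) ⟨
      (X % n % n + w % n) % n     ≡⟨ %-distribˡ-+ (X % n) w n ⟨
      (X % n + w) % n             ≡⟨ cong (_% n) (m+[n∸m]≡n (≤-trans (m%n≤n X n) (m≤n+m n (toℕ z)))) ⟩
      (toℕ z + n) % n             ≡⟨ [m+n]%n≡m%n (toℕ z) n ⟩
      toℕ z % n                   ≡⟨ m<n⇒m%n≡m (toℕ<n z) ⟩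
      toℕ z                       ∎)
    where
      open ≡-Reasoning
      w = toℕ z + n ∸ X % n

  cycleAdj⁺ : ∀ {x y : Fin n} → suc (toℕ x) % n ≡ toℕ y → CycleAdj n x y
  cycleAdj⁺ {x} {y} e with m≤n⇒m<n∨m≡n (toℕ<n x)
  ... | inj₁ 1+x<n = inj₁ (trans (sym (m<n⇒m%n≡m 1+x<n)) e)
  ... | inj₂ 1+x≡n = inj₂ (inj₂ (inj₂ (trans (sym e) (trans (cong (_% n) 1+x≡n) (n%n≡0 n)) , 1+x≡n)))

  cycleAdj⁻ : ∀ {x y : Fin n} → CycleAdj n x y → suc (toℕ x) % n ≡ toℕ y ⊎ suc (toℕ y) % n ≡ toℕ x
  cycleAdj⁻ {x} {y} (inj₁ e) = inj₁ (trans (m<n⇒m%n≡m (subst (_< n) (sym e) (toℕ<n y))) e)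
  cycleAdj⁻ {x} {y} (inj₂ (inj₁ e)) = inj₂ (trans (m<n⇒m%n≡m (subst (_< n) (sym e) (toℕ<n x))) e)
  cycleAdj⁻ (inj₂ (inj₂ (inj₁ (x≡0 , 1+y≡n)))) = inj₂ (trans (cong (_% n) 1+y≡n) (trans (n%n≡0 n) (sym x≡0)))
  cycleAdj⁻ (inj₂ (inj₂ (inj₂ (y≡0 , 1+x≡n)))) = inj₁ (trans (cong (_% n) 1+x≡n) (trans (n%n≡0 n) (sym y≡0)))

  suc-vertex% : ∀ X → suc (toℕ (vertex X)) % n ≡ suc X % n
  suc-vertex% X = begin
    suc (toℕ (vertex X)) % n     ≡⟨ cong (λ t → suc t % n) (toℕ-vertex X) ⟩
    (1 + X % n) % n              ≡⟨ %-distribˡ-+ 1 (X % n) n ⟩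
    (1 % n + X % n % n) % n      ≡⟨ cong (λ t → (1 % n + t) % n) (m%n%n≡m%n X n) ⟩
    (1 % n + X % n) % n          ≡⟨ %-distribˡ-+ 1 X n ⟨
    suc X % n                    ∎
    where open ≡-Reasoning

  cycleAdj-vertex⇔% : ∀ X Y → CycleAdj n (vertex X) (vertex Y) ⇔ (suc X % n ≡ Y % n ⊎ suc Y % n ≡ X % n)
  cycleAdj-vertex⇔% X Y = mk⇔ to from
    where
      to : CycleAdj n (vertex X) (vertex Y) → suc X % n ≡ Y % n ⊎ suc Y % n ≡ X % n
      to c with cycleAdj⁻ c
      ... | inj₁ e = inj₁ (trans (sym (suc-vertex% X)) (trans e (toℕ-vertex Y)))
      ... | inj₂ e = inj₂ (trans (sym (suc-vertex% Y)) (trans e (toℕ-vertex X)))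
      from : suc X % n ≡ Y % n ⊎ suc Y % n ≡ X % n → CycleAdj n (vertex X) (vertex Y)
      from (inj₁ e) = cycleAdj⁺ (trans (suc-vertex% X) (trans e (sym (toℕ-vertex Y))))
      from (inj₂ e) = cycleAdj-sym (cycleAdj⁺ (trans (suc-vertex% Y) (trans e (sym (toℕ-vertex X)))))

  cycleAdj-vertex⇔ : ∀ {X Y} → X ≤ Y → Y < X + n →
                     CycleAdj n (vertex X) (vertex Y) ⇔ (Y ≡ suc X ⊎ suc Y ≡ X + n)
  cycleAdj-vertex⇔ {X} {Y} X≤Y Y<X+n = mk⇔ (to ∘ Equivalence.to (cycleAdj-vertex⇔% X Y))
                                           (Equivalence.from (cycleAdj-vertex⇔% X Y) ∘ from)
    where
      X+n%≡X% : (X + n) % n ≡ X % n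
      X+n%≡X% = [m+n]%n≡m%n X n
      to : suc X % n ≡ Y % n ⊎ suc Y % n ≡ X % n → Y ≡ suc X ⊎ suc Y ≡ X + n
      to (inj₁ e) with m≤n⇒m<n∨m≡n X≤Y
      ... | inj₁ X<Y = inj₁ (sym (%-injective-window X<Y (<-≤-trans Y<X+n (n≤1+n _)) e))
      ... | inj₂ refl = contradiction (%-injective-window (n≤1+n X) (k+m<m+n X 1<n)
                                         (sym e)) (<⇒≢ (n<1+n X))
      to (inj₂ e) = inj₂ (%-injective-window Y<X+n (s≤s (+-monoˡ-≤ n X≤Y)) (trans e (sym X+n%≡X%)))
      from : Y ≡ suc X ⊎ suc Y ≡ X + n → suc X % n ≡ Y % n ⊎ suc Y % n ≡ X % n
      from (inj₁ e) = inj₁ (cong (_% n) (sym e))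
      from (inj₂ e) = inj₂ (trans (cong (_% n) e) X+n%≡X%)

  vertex-≢-shift : ∀ {k} X → 0 < k → k < n → vertex X ≢ vertex (k + X)
  vertex-≢-shift {k} X 0<k k<n vX≡vY =
    <⇒≢ (m<n+m X 0<k) (vertex-injective-window (m≤n+m X k) (k+m<m+n X k<n) vX≡vY)

  sqAdj-vertex⇔ : ∀ {X Y} → X ≤ Y → Y + 3 ≤ X + n →
                  SqAdj n (vertex X) (vertex Y) ⇔ (Y ≡ suc X ⊎ Y ≡ 2 + X)
  sqAdj-vertex⇔ {X} {Y} X≤Y Y+3≤X+n = mk⇔ to from
    where
      Y<X+n : Y < X + n
      Y<X+n = ≤-trans (m≤m+n (suc Y) 2) (subst (_≤ X + n) (+-suc Y 2) Y+3≤X+n)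
      X+n≰2+Y : X + n ≰ 2 + Y
      X+n≰2+Y X+n≤2+Y = 1+n≰n (≤-pred (≤-pred (subst (_≤ 2 + Y) (+-comm Y 3) (≤-trans Y+3≤X+n X+n≤2+Y))))
      Y≤Z : ∀ {Z} → suc Z ≡ X + n → Y ≤ Z
      Y≤Z 1+Z≡X+n = ≤-pred (≤-trans (subst (_≤ Y + 3) (+-comm Y 1) (+-monoʳ-≤ Y (s≤s z≤n)))
                                       (subst (Y + 3 ≤_) (sym 1+Z≡X+n) Y+3≤X+n))
      to : SqAdj n (vertex X) (vertex Y) → Y ≡ suc X ⊎ Y ≡ 2 + X
      to (_ , inj₁ c) with Equivalence.to (cycleAdj-vertex⇔ X≤Y Y<X+n) c
      ... | inj₁ Y≡1+X = inj₁ Y≡1+X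
      ... | inj₂ 1+Y≡X+n = contradiction (≤-trans (≤-reflexive (sym 1+Y≡X+n)) (n≤1+n _)) X+n≰2+Y
      to (x≢y , inj₂ (z , c₁ , c₂)) with vertex-window X z
      ... | Z , (X≤Z , Z<X+n) , refl with Equivalence.to (cycleAdj-vertex⇔ X≤Z Z<X+n) c₁
      ...   | inj₁ refl = via-successor (≤-total (suc X) Y)
        where
          via-successor : suc X ≤ Y ⊎ Y ≤ suc X → Y ≡ suc X ⊎ Y ≡ 2 + X
          via-successor (inj₁ 1+X≤Y)
            with Equivalence.to (cycleAdj-vertex⇔ 1+X≤Y (<-≤-trans Y<X+n (n≤1+n _))) c₂
          ... | inj₁ Y≡2+X = inj₂ Y≡2+X
          ... | inj₂ 1+Y≡1+X+n = contradiction (suc-injective 1+Y≡1+X+n) (<⇒≢ Y<X+n)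
          via-successor (inj₂ Y≤1+X) with m≤n⇒m<n∨m≡n Y≤1+X
          ... | inj₁ Y<1+X = contradiction (cong vertex (≤-antisym X≤Y (≤-pred Y<1+X))) x≢y
          ... | inj₂ Y≡1+X = inj₁ Y≡1+X
      ...   | inj₂ 1+Z≡X+n
        with Equivalence.to (cycleAdj-vertex⇔ (Y≤Z 1+Z≡X+n) (<-≤-trans Z<X+n (+-monoˡ-≤ n X≤Y))) (cycleAdj-sym c₂)
      ...     | inj₁ Z≡1+Y = contradiction (≤-reflexive (trans (sym 1+Z≡X+n) (cong suc Z≡1+Y))) X+n≰2+Y
      ...     | inj₂ 1+Z≡Y+n = contradiction (cong vertex (+-cancelʳ-≡ n X Y (trans (sym 1+Z≡X+n) 1+Z≡Y+n))) x≢y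
      from : Y ≡ suc X ⊎ Y ≡ 2 + X → SqAdj n (vertex X) (vertex Y)
      from (inj₁ refl) = vertex-≢-shift X (s≤s z≤n) 1<n
                       , inj₁ (Equivalence.from (cycleAdj-vertex⇔ (n≤1+n X) (k+m<m+n X 1<n)) (inj₁ refl))
      from (inj₂ refl) = vertex-≢-shift X (s≤s z≤n) 3≤n
                       , inj₂ (vertex (suc X)
                              , Equivalence.from (cycleAdj-vertex⇔ (n≤1+n X) (k+m<m+n X 1<n)) (inj₁ refl)
                              , Equivalence.from (cycleAdj-vertex⇔ (n≤1+n (suc X)) (k+m<m+n (suc X) 1<n)) (inj₁ refl))

module SquarePathWalk (n : ℕ) (3≤n : 3 ≤ n) (ℓ : ℕ) (u : ℕ → ℕ)
    (u-step   : ∀ {a} → a < ℓ → u (suc a) ≡ suc (u a) ⊎ u (suc a) ≡ 2 + u a)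
    (u-spread : ∀ {a} → suc a < ℓ → 3 + u a ≤ u (2 + a))
    (u-span   : u ℓ + 3 ≡ u 0 + n) where

  open Cycle n 3≤n

  u-<-suc : ∀ {a} → a < ℓ → u a < u (suc a)
  u-<-suc {a} a<ℓ with u-step a<ℓ
  ... | inj₁ e = ≤-reflexive (sym e)
  ... | inj₂ e = ≤-trans (n≤1+n (suc (u a))) (≤-reflexive (sym e))

  u-consecutive-or-far : ∀ {a b} → a < b → b ≤ ℓ → b ≡ suc a ⊎ 3 + u a ≤ u b
  u-consecutive-or-far {a} {suc b} a<1+b 1+b≤ℓ with m≤n⇒m<n∨m≡n (≤-pred a<1+b)
  ... | inj₂ refl = inj₁ refl
  ... | inj₁ a<b with u-consecutive-or-far a<b (<⇒≤ 1+b≤ℓ)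
  ...   | inj₁ refl = inj₂ (u-spread 1+b≤ℓ)
  ...   | inj₂ 3+ua≤ub = inj₂ (≤-trans 3+ua≤ub (<⇒≤ (u-<-suc 1+b≤ℓ)))

  u-strict : ∀ {a b} → a < b → b ≤ ℓ → u a < u b
  u-strict {a} a<b b≤ℓ with u-consecutive-or-far a<b b≤ℓ
  ... | inj₁ refl = u-<-suc b≤ℓ
  ... | inj₂ 3+ua≤ub = ≤-trans (s≤s (m≤n+m (u a) 2)) 3+ua≤ub

  u-mono : ∀ {a b} → a ≤ b → b ≤ ℓ → u a ≤ u b
  u-mono a≤b b≤ℓ with m≤n⇒m<n∨m≡n a≤b
  ... | inj₁ a<b = <⇒≤ (u-strict a<b b≤ℓ)
  ... | inj₂ refl = ≤-refl

  u-injective : ∀ {a b} → a ≤ ℓ → b ≤ ℓ → u a ≡ u b → a ≡ b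
  u-injective {a} {b} a≤ℓ b≤ℓ ua≡ub with <-cmp a b
  ... | tri< a<b _ _ = contradiction ua≡ub (<⇒≢ (u-strict a<b b≤ℓ))
  ... | tri≈ _ a≡b _ = a≡b
  ... | tri> _ _ b<a = contradiction (sym ua≡ub) (<⇒≢ (u-strict b<a a≤ℓ))

  u-window : ∀ {a} → a ≤ ℓ → u 0 ≤ u a × u a < u 0 + n
  u-window a≤ℓ = u-mono z≤n a≤ℓ , ≤-trans (s≤s (≤-trans (u-mono a≤ℓ ≤-refl) (m≤m+n (u ℓ) 2)))
                                          (≤-reflexive (trans (sym (+-suc (u ℓ) 2)) u-span))

  u-suc≤2+ : ∀ {a} → a < ℓ → u (suc a) ≤ 2 + u a
  u-suc≤2+ {a} a<ℓ with u-step a<ℓ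
  ... | inj₁ e = ≤-trans (≤-reflexive e) (n≤1+n _)
  ... | inj₂ e = ≤-reflexive e

  toℕ≤ℓ : (a : Fin (suc ℓ)) → toℕ a ≤ ℓ
  toℕ≤ℓ a = ≤-pred (toℕ<n a)

  OnWalk : Fin n → Set
  OnWalk x = ∃ λ (a : Fin (suc ℓ)) → vertex (u (toℕ a)) ≡ x

  onWalk? : Decidable OnWalk
  onWalk? x = any? λ a → vertex (u (toℕ a)) ≟ᶠ x

  walkSet : Subset n
  walkSet = tabulate (does ∘ onWalk?)

  vertex-u∈walkSet : ∀ {a} → a ≤ ℓ → vertex (u a) ∈ walkSet
  vertex-u∈walkSet a≤ℓ = ∈-tabulate⁺ onWalk? (fromℕ< (s≤s a≤ℓ) , cong (vertex ∘ u) (toℕ-fromℕ< (s≤s a≤ℓ)))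

  vertex∉walkSet : ∀ {Z} → u 0 ≤ Z → Z < u 0 + n → (∀ {a} → a ≤ ℓ → u a ≢ Z) → vertex Z ∉ walkSet
  vertex∉walkSet u0≤Z Z<u0+n Z∉u Z∈ with ∈-tabulate⁻ onWalk? Z∈
  ... | a , e = Z∉u a≤ℓ (vertex-injectiveOn-window (u-window a≤ℓ) (u0≤Z , Z<u0+n) e)
    where a≤ℓ = toℕ≤ℓ a

  skipped∉walkSet : ∀ {a Z} → suc a ≤ ℓ → u a < Z → Z < u (suc a) → vertex Z ∉ walkSet
  skipped∉walkSet {a} {Z} a<ℓ ua<Z Z<ua+1 =
    vertex∉walkSet (≤-trans (u-mono z≤n (<⇒≤ a<ℓ)) (<⇒≤ ua<Z)) (<-trans Z<ua+1 (proj₂ (u-window a<ℓ))) ub≢Z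
    where
      ub≢Z : ∀ {b} → b ≤ ℓ → u b ≢ Z
      ub≢Z {b} b≤ℓ ub≡Z with b ≤? a
      ... | yes b≤a = <⇒≱ ua<Z (subst (_≤ u a) ub≡Z (u-mono b≤a (<⇒≤ a<ℓ)))
      ... | no b≰a  = <⇒≱ Z<ua+1 (subst (u (suc a) ≤_) ub≡Z (u-mono (≰⇒> b≰a) b≤ℓ))

  pastEnd∉walkSet : ∀ {k} → 0 < k → k < 3 → vertex (k + u ℓ) ∉ walkSet
  pastEnd∉walkSet {k} 0<k k<3 =
    vertex∉walkSet (≤-trans (u-mono z≤n ≤-refl) (<⇒≤ uℓ<k+uℓ))
                   (subst (k + u ℓ <_) (trans (+-comm 3 (u ℓ)) u-span) (+-monoˡ-< (u ℓ) k<3))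
                   (λ b≤ℓ ub≡k+uℓ → <⇒≱ uℓ<k+uℓ (subst (_≤ u ℓ) ub≡k+uℓ (u-mono b≤ℓ ≤-refl)))
    where uℓ<k+uℓ = m<n+m (u ℓ) 0<k

  path : Fin (suc ℓ) → Fin n
  path a = vertex (u (toℕ a))

  consecutive⇔ : ∀ {a b} → a ≤ b → b ≤ ℓ → (u b ≡ suc (u a) ⊎ u b ≡ 2 + u a) ⇔ b ≡ suc a
  consecutive⇔ {a} {b} a≤b b≤ℓ = mk⇔ to λ { refl → u-step b≤ℓ }
    where
      between : u b ≡ suc (u a) ⊎ u b ≡ 2 + u a → u a < u b × u b ≤ 2 + u a
      between (inj₁ e) = ≤-reflexive (sym e) , ≤-trans (≤-reflexive e) (n≤1+n _)
      between (inj₂ e) = ≤-trans (n≤1+n _) (≤-reflexive (sym e)) , ≤-reflexive e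
      to : u b ≡ suc (u a) ⊎ u b ≡ 2 + u a → b ≡ suc a
      to close with m≤n⇒m<n∨m≡n a≤b
      ... | inj₂ refl = contradiction (proj₁ (between close)) (<-irrefl refl)
      ... | inj₁ a<b with u-consecutive-or-far a<b b≤ℓ
      ...   | inj₁ b≡1+a = b≡1+a
      ...   | inj₂ 3+ua≤ub = contradiction (≤-trans 3+ua≤ub (proj₂ (between close))) 1+n≰n

  sqAdj-path-ordered : ∀ {a b} → toℕ a ≤ toℕ b → SqAdj n (path a) (path b) ⇔ toℕ b ≡ suc (toℕ a)
  sqAdj-path-ordered {a} {b} a≤b =
    consecutive⇔ a≤b b≤ℓ ⇔-∘ sqAdj-vertex⇔ (u-mono a≤b b≤ℓ) window
    where
      b≤ℓ = toℕ≤ℓ b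
      window : u (toℕ b) + 3 ≤ u (toℕ a) + n
      window = ≤-trans (+-monoˡ-≤ 3 (u-mono b≤ℓ ≤-refl))
                       (≤-trans (≤-reflexive u-span) (+-monoˡ-≤ n (u-mono z≤n (≤-trans a≤b b≤ℓ))))

  sqAdj-path⇔ : ∀ a b → SqAdj n (path a) (path b) ⇔ PathAdj (suc ℓ) a b
  sqAdj-path⇔ a b with ≤-total (toℕ a) (toℕ b)
  ... | inj₁ a≤b = ⇔-sym (pathAdj-ordered a≤b) ⇔-∘ sqAdj-path-ordered a≤b
  ... | inj₂ b≤a = mk⇔ (swap ∘ Equivalence.to ordered ∘ sqAdj-sym)
                       (sqAdj-sym ∘ Equivalence.from ordered ∘ swap)
    where ordered = ⇔-sym (pathAdj-ordered b≤a) ⇔-∘ sqAdj-path-ordered b≤a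

  walkSet-path : SqIsPath n walkSet
  walkSet-path = suc ℓ , s≤s z≤n , path
               , (vertex-u∈walkSet ∘ toℕ≤ℓ)
               , (λ x → ∈-tabulate⁻ onWalk?)
               , (λ a b → toℕ-injective ∘ u-injective (toℕ≤ℓ a) (toℕ≤ℓ b)
                                          ∘ vertex-injectiveOn-window (u-window (toℕ≤ℓ a)) (u-window (toℕ≤ℓ b)))
               , sqAdj-path⇔

  u-cover : ∀ {b Z} → b ≤ ℓ → u 0 ≤ Z → Z ≤ u b → ∃ λ a → a ≤ ℓ × (u a ≡ Z ⊎ u a ≡ suc Z)
  u-cover {zero}  _ u0≤Z Z≤u0 = 0 , z≤n , inj₁ (≤-antisym u0≤Z Z≤u0)
  u-cover {suc b} {Z} b<ℓ u0≤Z Z≤ub+1 with Z ≤? u b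
  ... | yes Z≤ub = u-cover (<⇒≤ b<ℓ) u0≤Z Z≤ub
  ... | no Z≰ub with m≤n⇒m<n∨m≡n Z≤ub+1
  ...   | inj₂ Z≡ub+1 = suc b , b<ℓ , inj₁ (sym Z≡ub+1)
  ...   | inj₁ Z<ub+1 = suc b , b<ℓ , inj₂ (≤-antisym (≤-trans (u-suc≤2+ b<ℓ) (s≤s (≰⇒> Z≰ub))) Z<ub+1)

  consecutive∉walkSet : ∀ {X} → u 0 ≤ X → X < u 0 + n → vertex X ∉ walkSet → vertex (suc X) ∉ walkSet →
                 X ≡ suc (u ℓ)
  consecutive∉walkSet {X} u0≤X X<u0+n X∉ X+1∉ with X ≤? u ℓ
  ... | yes X≤uℓ with u-cover ≤-refl u0≤X X≤uℓ
  ...   | a , a≤ℓ , inj₁ ua≡X   = contradiction (subst (_∈ walkSet) (cong vertex ua≡X) (vertex-u∈walkSet a≤ℓ)) X∉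
  ...   | a , a≤ℓ , inj₂ ua≡X+1 = contradiction (subst (_∈ walkSet) (cong vertex ua≡X+1) (vertex-u∈walkSet a≤ℓ)) X+1∉
  consecutive∉walkSet {X} u0≤X X<u0+n X∉ X+1∉ | no X≰uℓ with m≤n⇒m<n∨m≡n X<u0+n
  ... | inj₂ X+1≡u0+n = contradiction (subst (_∈ walkSet) vertex-u0≡ (vertex-u∈walkSet z≤n)) X+1∉
    where vertex-u0≡ = trans (sym (vertex-+n (u 0))) (cong vertex (sym X+1≡u0+n))
  ... | inj₁ X+1<u0+n = ≤-antisym X≤1+uℓ (≰⇒> X≰uℓ)
    where X≤1+uℓ = ≤-pred (≤-pred (subst (2 + X ≤_) (trans (sym u-span) (+-comm (u ℓ) 3)) X+1<u0+n))

  adjacent∉walkSet : ∀ {X Y} → X ≤ Y → u 0 ≤ X → Y < u 0 + n →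
                 vertex X ∉ walkSet → vertex Y ∉ walkSet → CycleAdj n (vertex X) (vertex Y) →
                 X ≡ suc (u ℓ) × Y ≡ 2 + u ℓ
  adjacent∉walkSet {X} {Y} X≤Y u0≤X Y<u0+n X∉ Y∉ c
    with Equivalence.to (cycleAdj-vertex⇔ X≤Y (<-≤-trans Y<u0+n (+-monoˡ-≤ n u0≤X))) c
  ... | inj₁ refl = X≡ , cong suc X≡
    where X≡ = consecutive∉walkSet u0≤X (<-trans (n<1+n X) Y<u0+n) X∉ Y∉
  ... | inj₂ 1+Y≡X+n = contradiction (subst (_∈ walkSet) (cong vertex u0≡X) (vertex-u∈walkSet z≤n)) X∉
    where u0≡X = ≤-antisym u0≤X (+-cancelʳ-≤ n X (u 0) (subst (_≤ u 0 + n) 1+Y≡X+n Y<u0+n))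

  walkSet-onlyAdjPair : OnlyAdjPairOutside n walkSet (vertex (suc (u ℓ))) (vertex (2 + u ℓ))
  walkSet-onlyAdjPair x y x∉ y∉ c with vertex-window (u 0) x | vertex-window (u 0) y
  ... | X , (u0≤X , X<u0+n) , refl | Y , (u0≤Y , Y<u0+n) , refl with ≤-total X Y
  ...   | inj₁ X≤Y = let X≡ , Y≡ = adjacent∉walkSet X≤Y u0≤X Y<u0+n x∉ y∉ c
                     in inj₁ (cong vertex X≡ , cong vertex Y≡)
  ...   | inj₂ Y≤X = let Y≡ , X≡ = adjacent∉walkSet Y≤X u0≤Y X<u0+n y∉ x∉ (cycleAdj-sym c)
                     in inj₂ (cong vertex X≡ , cong vertex Y≡)

PathAvoiding : (n : ℕ) → Fin n → Set
PathAvoiding n i = ∃ λ (A : Subset n) → ∃ λ (j : Fin n) →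
  ((toℕ j + 1 ≡ toℕ i) ⊎ (toℕ j ≡ toℕ i + 1))
  × (∀ (v₁ : Fin n) → toℕ v₁ ≡ 0 → v₁ ∉ A)
  × i ∉ A × j ∉ A
  × OnlyAdjPairOutside n A i j
  × SqIsPath n A

module OddCycleWalk (n q r : ℕ) (n≡ : n ≡ 2 * (q + r) + 3) where

  3≤n : 3 ≤ n
  3≤n = subst (3 ≤_) (sym n≡) (m≤n+m 3 _)

  u : ℕ → ℕ
  u a = 2 * (suc q + a)

  u-suc : ∀ a → u (suc a) ≡ 2 + u a
  u-suc a = trans (cong (2 *_) (+-suc (suc q) a)) (*-suc 2 (suc q + a))

  u-span : u (q + r) + 3 ≡ u 0 + n
  u-span = trans (identity q r) (cong (u 0 +_) (sym n≡))
    where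
      identity : ∀ q r → 2 * (suc q + (q + r)) + 3 ≡ 2 * (suc q + 0) + (2 * (q + r) + 3)
      identity = solve-∀

  u-spread : ∀ a → 3 + u a ≤ u (2 + a)
  u-spread a = ≤-trans (n≤1+n _) (≤-reflexive (sym (trans (u-suc (suc a)) (cong (2 +_) (u-suc a)))))

  open Cycle n 3≤n public
  open SquarePathWalk n 3≤n (q + r) u (λ {a} _ → inj₂ (u-suc a)) (λ {a} _ → u-spread a) u-span public

  endpoint₀≡ : vertex (1 + u (q + r)) ≡ vertex (2 * q)
  endpoint₀≡ = trans (cong vertex (trans (identity q r) (cong (2 * q +_) (sym n≡)))) (vertex-+n (2 * q))
    where
      identity : ∀ q r → 1 + 2 * (suc q + (q + r)) ≡ 2 * q + (2 * (q + r) + 3)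
      identity = solve-∀

  endpoint₁≡ : vertex (2 + u (q + r)) ≡ vertex (suc (2 * q))
  endpoint₁≡ = trans (cong vertex (trans (identity q r) (cong (suc (2 * q) +_) (sym n≡))))
                     (vertex-+n (suc (2 * q)))
    where
      identity : ∀ q r → 2 + 2 * (suc q + (q + r)) ≡ suc (2 * q) + (2 * (q + r) + 3)
      identity = solve-∀

  onlyAdjPair : OnlyAdjPairOutside n walkSet (vertex (2 * q)) (vertex (suc (2 * q)))
  onlyAdjPair = subst₂ (OnlyAdjPairOutside n walkSet) endpoint₀≡ endpoint₁≡ walkSet-onlyAdjPair

  endpoint₀∉ : vertex (2 * q) ∉ walkSet
  endpoint₀∉ = subst (_∉ walkSet) endpoint₀≡ (pastEnd∉walkSet (s≤s z≤n) (s≤s (s≤s z≤n)))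

  endpoint₁∉ : vertex (suc (2 * q)) ∉ walkSet
  endpoint₁∉ = subst (_∉ walkSet) endpoint₁≡ (pastEnd∉walkSet (s≤s z≤n) ≤-refl)

  1+2q<n : suc (2 * q) < n
  1+2q<n = ≤-trans (m≤m+n (2 + 2 * q) (1 + 2 * r)) (≤-reflexive (trans (identity q r) (sym n≡)))
    where
      identity : ∀ q r → 2 + 2 * q + (1 + 2 * r) ≡ 2 * (q + r) + 3
      identity = solve-∀

  -- Vertex 0 = n lies strictly between the walk terms u r = n - 1 and u (r + 1) = n + 1.
  v₁∉walkSet : 1 ≤ q → ∀ (v : Fin n) → toℕ v ≡ 0 → v ∉ walkSet
  v₁∉walkSet 1≤q v v≡0 =
    subst (_∉ walkSet) v≡vertex-n (skipped∉walkSet (+-monoˡ-≤ r 1≤q) ur<n n<ur+1)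
    where
      v≡vertex-n : vertex n ≡ v
      v≡vertex-n = trans (vertex-+n 0) (trans (cong vertex (sym v≡0)) (vertex-toℕ v))
      ur<n : u r < n
      ur<n = ≤-reflexive (trans (identity q r) (sym n≡))
        where
          identity : ∀ q r → suc (2 * (suc q + r)) ≡ 2 * (q + r) + 3
          identity = solve-∀
      n<ur+1 : n < u (suc r)
      n<ur+1 = ≤-reflexive (trans (cong suc n≡) (identity q r))
        where
          identity : ∀ q r → suc (2 * (q + r) + 3) ≡ 2 * (suc q + suc r)
          identity = solve-∀

  toℕ-vertex-2q : toℕ (vertex (2 * q)) ≡ 2 * q
  toℕ-vertex-2q = toℕ-vertex-< (<-trans (n<1+n _) 1+2q<n)

  toℕ-vertex-1+2q : toℕ (vertex (suc (2 * q))) ≡ suc (2 * q)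
  toℕ-vertex-1+2q = toℕ-vertex-< 1+2q<n

  pathAvoiding-even : 1 ≤ q → PathAvoiding n (vertex (2 * q))
  pathAvoiding-even 1≤q = walkSet , vertex (suc (2 * q))
    , inj₂ (trans toℕ-vertex-1+2q (trans (cong suc (sym toℕ-vertex-2q)) (+-comm 1 _)))
    , v₁∉walkSet 1≤q , endpoint₀∉ , endpoint₁∉ , onlyAdjPair , walkSet-path

  pathAvoiding-odd : 1 ≤ q → PathAvoiding n (vertex (suc (2 * q)))
  pathAvoiding-odd 1≤q = walkSet , vertex (2 * q)
    , inj₁ (trans (+-comm _ 1) (trans (cong suc toℕ-vertex-2q) (sym toℕ-vertex-1+2q)))
    , v₁∉walkSet 1≤q , endpoint₁∉ , endpoint₀∉ , onlyAdjPair-sym onlyAdjPair , walkSet-path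

module EvenCycleWalk (n k : ℕ) (n≡ : n ≡ 2 * k + 4) where

  3≤n : 3 ≤ n
  3≤n = subst (3 ≤_) (sym n≡) (≤-trans (n≤1+n 3) (m≤n+m 4 _))

  u : ℕ → ℕ
  u zero    = 0
  u (suc a) = suc (2 * a)

  u-suc-suc : ∀ a → u (2 + a) ≡ 2 + u (suc a)
  u-suc-suc a = cong suc (*-suc 2 a)

  u-step : ∀ {a} → a < suc k → u (suc a) ≡ suc (u a) ⊎ u (suc a) ≡ 2 + u a
  u-step {zero}  _ = inj₁ refl
  u-step {suc a} _ = inj₂ (u-suc-suc a)

  u-spread : ∀ {a} → suc a < suc k → 3 + u a ≤ u (2 + a)
  u-spread {zero}  _ = ≤-refl
  u-spread {suc a} _ =
    ≤-trans (n≤1+n _) (≤-reflexive (sym (trans (u-suc-suc (suc a)) (cong (2 +_) (u-suc-suc a)))))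

  u-span : u (suc k) + 3 ≡ u 0 + n
  u-span = trans (identity k) (sym n≡)
    where
      identity : ∀ k → suc (2 * k) + 3 ≡ 2 * k + 4
      identity = solve-∀

  open Cycle n 3≤n public
  open SquarePathWalk n 3≤n (suc k) u u-step u-spread u-span public

parity : ∀ x → ∃ λ h → x ≡ 2 * h ⊎ x ≡ suc (2 * h)
parity zero = 0 , inj₁ refl
parity (suc x) with parity x
... | h , inj₁ x≡2h   = h , inj₂ (cong suc x≡2h)
... | h , inj₂ x≡1+2h = suc h , inj₁ (trans (cong suc x≡1+2h) (sym (*-suc 2 h)))

squarePath-oneAdjPairOutside : ∀ n → 3 ≤ n → ∃ λ (A : Subset n) → AtMostOneAdjPairOutside n A × SqIsPath n A
squarePath-oneAdjPairOutside n 3≤n with parity n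
... | 0 , inj₁ refl = contradiction 3≤n λ ()
... | 1 , inj₁ refl = contradiction 3≤n λ { (s≤s (s≤s ())) }
... | 0 , inj₂ refl = contradiction 3≤n λ { (s≤s ()) }
... | suc (suc k) , inj₁ n≡ = walkSet , onlyAdjPair⇒atMostOne walkSet-onlyAdjPair , walkSet-path
  where
    identity : ∀ k → 2 * suc (suc k) ≡ 2 * k + 4
    identity = solve-∀
    open EvenCycleWalk n k (trans n≡ (identity k))
... | suc r , inj₂ n≡ = walkSet , onlyAdjPair⇒atMostOne walkSet-onlyAdjPair , walkSet-path
  where
    identity : ∀ r → suc (2 * suc r) ≡ 2 * (0 + r) + 3
    identity = solve-∀
    open OddCycleWalk n 0 r (trans n≡ (identity r))

odd-split : ∀ {n} h q → n ≡ suc (2 * h) → 2 * q + 2 ≤ n → ∃ λ r → n ≡ 2 * (q + r) + 3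
odd-split {n} h q n≡1+2h 2q+2≤n =
  r , trans n≡1+2h (trans (cong (λ t → suc (2 * t)) (sym 1+q+r≡h)) (identity q r))
  where
    identity : ∀ q r → suc (2 * (suc q + r)) ≡ 2 * (q + r) + 3
    identity = solve-∀
    q<h : q < h
    q<h = ≤-pred (*-cancelˡ-< 2 (suc q) (suc h) (begin-strict
      2 * suc q           ≡⟨ *-suc 2 q ⟩
      2 + 2 * q           ≡⟨ +-comm 2 (2 * q) ⟩
      2 * q + 2           ≤⟨ 2q+2≤n ⟩
      n                   ≡⟨ n≡1+2h ⟩
      suc (2 * h)         <⟨ n<1+n _ ⟩
      2 + 2 * h           ≡⟨ *-suc 2 h ⟨
      2 * suc h           ∎))
      where open ≤-Reasoning
    r = proj₁ (m≤n⇒∃[o]m+o≡n q<h)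
    1+q+r≡h = proj₂ (m≤n⇒∃[o]m+o≡n q<h)

oddCycle-pathAvoiding-at : ∀ {n} h q → n ≡ suc (2 * h) → 1 ≤ q → (i : Fin n) → toℕ i ≤ n ∸ 2 →
                           toℕ i ≡ 2 * q ⊎ toℕ i ≡ suc (2 * q) → PathAvoiding n i
oddCycle-pathAvoiding-at {n} h q n≡1+2h 1≤q i i≤n∸2 i≡ = avoid i≡
  where
    2q≤i : 2 * q ≤ toℕ i
    2q≤i = lower i≡
      where
        lower : toℕ i ≡ 2 * q ⊎ toℕ i ≡ suc (2 * q) → 2 * q ≤ toℕ i
        lower (inj₁ i≡2q)   = ≤-reflexive (sym i≡2q)
        lower (inj₂ i≡1+2q) = ≤-trans (n≤1+n _) (≤-reflexive (sym i≡1+2q))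
    2≤n : 2 ≤ n
    2≤n = ≤-trans (*-monoʳ-≤ 2 1≤q) (≤-trans 2q≤i (<⇒≤ (toℕ<n i)))
    split : ∃ λ r → n ≡ 2 * (q + r) + 3
    split = odd-split h q n≡1+2h (≤-trans (+-monoˡ-≤ 2 (≤-trans 2q≤i i≤n∸2)) (≤-reflexive (m∸n+n≡m 2≤n)))
    open OddCycleWalk n q (proj₁ split) (proj₂ split)
    vertex≡i : ∀ {X} → toℕ i ≡ X → vertex X ≡ i
    vertex≡i i≡X = trans (cong vertex (sym i≡X)) (vertex-toℕ i)
    avoid : toℕ i ≡ 2 * q ⊎ toℕ i ≡ suc (2 * q) → PathAvoiding n i
    avoid (inj₁ i≡2q)   = subst (PathAvoiding n) (vertex≡i i≡2q) (pathAvoiding-even 1≤q)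
    avoid (inj₂ i≡1+2q) = subst (PathAvoiding n) (vertex≡i i≡1+2q) (pathAvoiding-odd 1≤q)

oddCycle-pathAvoiding : ∀ n → n % 2 ≡ 1 → (i : Fin n) → 2 ≤ toℕ i → toℕ i ≤ n ∸ 2 → PathAvoiding n i
oddCycle-pathAvoiding n n-odd i 2≤i i≤n∸2 with parity n | parity (toℕ i)
... | h , inj₁ n≡2h | _ =
  contradiction (trans (sym n-odd) (trans (cong (_% 2) (trans n≡2h (*-comm 2 h))) (m*n%n≡0 h 2))) λ ()
... | _ , inj₂ _ | 0 , inj₁ i≡0 = contradiction (subst (2 ≤_) i≡0 2≤i) λ ()
... | _ , inj₂ _ | 0 , inj₂ i≡1 = contradiction (subst (2 ≤_) i≡1 2≤i) λ { (s≤s ()) }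
... | h , inj₂ n≡1+2h | suc p , i≡ = oddCycle-pathAvoiding-at h (suc p) n≡1+2h (s≤s z≤n) i i≤n∸2 i≡

mainTheorem4 : (n : ℕ) → 3 ≤ n →
    (∃ λ (A : Subset n) → AtMostOneAdjPairOutside n A × (SqIsEvenCycle n A ⊎ SqIsPath n A))
    × (n % 2 ≡ 1 → (i : Fin n) → 2 ≤ toℕ i → toℕ i ≤ n ∸ 2 →
        ∃ λ (A : Subset n) → ∃ λ (j : Fin n) →
          ((toℕ j + 1 ≡ toℕ i) ⊎ (toℕ j ≡ toℕ i + 1))
          × (∀ (v₁ : Fin n) → toℕ v₁ ≡ 0 → v₁ ∉ A)
          × i ∉ A × j ∉ A
          × OnlyAdjPairOutside n A i j
          × SqIsPath n A)
mainTheorem4 n 3≤n = part-i , oddCycle-pathAvoiding n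
  where
    part-i : ∃ λ (A : Subset n) → AtMostOneAdjPairOutside n A × (SqIsEvenCycle n A ⊎ SqIsPath n A)
    part-i with squarePath-oneAdjPairOutside n 3≤n
    ... | A , atMostOne , path = A , atMostOne , inj₂ path
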